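{- Every graph $B$ with $m(B) \le m_2(C_4) = 3/2$ satisfies $B \not\xrightarrow{\mathrm{c-ram}} (K_{1,3}, C_4)$; that is, $B$ has an edge-colouring with no monochromatic copy of $K_{1,3}$ and no rainbow copy of $C_4$.
   Context: $m(B) = \max\{e(J)/v(J) : J \subseteq B,\ v(J)\ge 1\}$. $m_2(C_4) = (4-1)/(4-2) = 3/2$. $G \xrightarrow{\mathrm{c-ram}} (H_1,H_2)$ means every edge-colouring of $G$ contains either a monochromatic copy of $H_1$ or a rainbow copy of $H_2$ (all edges of distinct colours). $C_4$ is the cycle of length 4 and $K_{1,3}$ the star with three edges. -}

module Defs where

open import Data.Nat using (ℕ; zero; suc; _+_; _*_; _≤_; _<ᵇ_)
open import Data.Fin using (Fin; zero; suc; toℕ)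
open import Data.Bool using (Bool; true; false; _∧_; T)
open import Data.Product using (Σ; _×_; ∃)
open import Relation.Binary.PropositionalEquality using (_≡_; _≢_)
open import Relation.Nullary using (¬_)
open import Data.Sum using (_⊎_)

count : ∀ {n} → (Fin n → Bool) → ℕ
count {zero}  P = 0
count {suc n} P = b2n (P zero) + count (λ i → P (suc i))
  where
  b2n : Bool → ℕ
  b2n true  = 1
  b2n false = 0

sumFin : ∀ {n} → (Fin n → ℕ) → ℕ
sumFin {zero}  f = 0
sumFin {suc n} f = f zero + sumFin (λ i → f (suc i))

record Graph (n : ℕ) : Set where
  field
    adj   : Fin n → Fin n → Bool
    sym   : ∀ u v → adj u v ≡ adj v u
    irrefl : ∀ u → adj u u ≡ false
open Graph public

record Subgraph {n : ℕ} (B : Graph n) : Set where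
  field
    vs    : Fin n → Bool
    es    : Fin n → Fin n → Bool
    es-sym : ∀ u v → es u v ≡ es v u
    es⊆adj : ∀ u v → T (es u v) → T (adj B u v)
    es⊆vs  : ∀ u v → T (es u v) → T (vs u) × T (vs v)
open Subgraph public

vJ : ∀ {n} {B : Graph n} → Subgraph B → ℕ
vJ J = count (vs J)

eJ : ∀ {n} {B : Graph n} → Subgraph B → ℕ
eJ J = sumFin (λ u → count (λ v → (toℕ u <ᵇ toℕ v) ∧ es J u v))

m≤3/2 : ∀ {n} → Graph n → Set
m≤3/2 B = ∀ (J : Subgraph B) → 1 ≤ vJ J → 2 * eJ J ≤ 3 * vJ J

-- an edge-colouring of B (colours are natural numbers; the colour of edge uv
-- is c u v = c v u; values on non-edges are irrelevant)
record EdgeColouring {n : ℕ} (B : Graph n) : Set where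
  field
    col : Fin n → Fin n → ℕ
    col-sym : ∀ u v → col u v ≡ col v u
open EdgeColouring public

MonoK13 : ∀ {n} (B : Graph n) → EdgeColouring B → Set
MonoK13 {n} B c =
  Σ (Fin n) λ x → Σ (Fin n) λ a → Σ (Fin n) λ b → Σ (Fin n) λ d →
    (x ≢ a) × (x ≢ b) × (x ≢ d) × (a ≢ b) × (a ≢ d) × (b ≢ d) ×
    T (adj B x a) × T (adj B x b) × T (adj B x d) ×
    (col c x a ≡ col c x b) × (col c x a ≡ col c x d)

RainbowC4 : ∀ {n} (B : Graph n) → EdgeColouring B → Set
RainbowC4 {n} B c =
  Σ (Fin n) λ v0 → Σ (Fin n) λ v1 → Σ (Fin n) λ v2 → Σ (Fin n) λ v3 →
    (v0 ≢ v1) × (v0 ≢ v2) × (v0 ≢ v3) × (v1 ≢ v2) × (v1 ≢ v3) × (v2 ≢ v3) ×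
    T (adj B v0 v1) × T (adj B v1 v2) × T (adj B v2 v3) × T (adj B v3 v0) ×
    (col c v0 v1 ≢ col c v1 v2) × (col c v0 v1 ≢ col c v2 v3) ×
    (col c v0 v1 ≢ col c v3 v0) × (col c v1 v2 ≢ col c v2 v3) ×
    (col c v1 v2 ≢ col c v3 v0) × (col c v2 v3 ≢ col c v3 v0)

ConstrainedRamsey-K13-C4 : ∀ {n} → Graph n → Set
ConstrainedRamsey-K13-C4 B =
  ∀ (c : EdgeColouring B) → MonoK13 B c ⊎ RainbowC4 B c

{-# OPTIONS --safe #-}
module Submission where

-- Peel off, one at a time, vertices of degree at most 2 in the remaining induced subgraph and give
-- all edges at a peeled vertex one fresh colour: a vertex of degree ≤ 2 centres no 3-star, a 3-star
-- with a leaf there has exactly one edge of that colour, and a 4-cycle through it uses two of its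
-- edges.  When no such vertex is left, the density bound m(B) ≤ 3/2 and the handshake lemma force
-- every remaining degree to be exactly 3.  Such a graph has a greedy 3-edge-colouring in which no
-- vertex sees one colour three times (each endpoint of a new edge forbids at most one colour), and
-- with only three colours no 4-cycle is rainbow.

open import Defs hiding (sym)
open import Algebra.Bundles using (CommutativeMonoid)
open import Data.Empty using (⊥)
open import Data.Bool using (Bool; true; false; _∧_; not; T; if_then_else_)
open import Data.Bool.Properties using (T-∧; ∧-identityʳ; ∧-zeroʳ; ∧-commutativeMonoid)
open import Data.Fin using (Fin; zero; suc; toℕ)
open import Data.Fin.Properties using (_≟_; any?; toℕ-injective; toℕ<n)
open import Data.List using (List; []; _∷_; length; cartesianProduct; allFin)
open import Data.List.Membership.Propositional.Properties using (∈-cartesianProduct⁺; ∈-allFin)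
open import Data.List.Relation.Unary.All as All using (All; []; _∷_)
open import Data.List.Relation.Unary.AllPairs using ([]; _∷_)
open import Data.List.Relation.Unary.Any as Any using (Any; here; there)
open import Data.List.Relation.Unary.Unique.Propositional using (Unique)
open import Data.Nat using (ℕ; zero; suc; _+_; _*_; _≤_; _<_; _<ᵇ_; z≤n; s≤s; s≤s⁻¹; _≤?_)
open import Data.Nat.Properties
  using (≤-refl; ≤-trans; ≤-reflexive; <-trans; <-irrefl; ≤⇒≯; ≰⇒>; +-mono-≤; +-mono-<-≤; +-mono-≤-<;
         m≤m+n; n≤1+n; +-suc; +-identityʳ; *-suc; *-identityˡ; *-zeroʳ; +-commutativeSemigroup;
         module ≤-Reasoning)
open import Data.Product using (Σ; _×_; _,_; proj₁; proj₂; ∃)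
open import Data.Product.Properties using (≡-dec)
open import Data.Sum using (_⊎_; inj₁; inj₂; [_,_]) renaming (swap to ⊎-swap)
open import Data.Unit using (tt)
open import Function using (_∘_; Equivalence)
open import Relation.Binary.PropositionalEquality
  using (_≡_; _≢_; refl; sym; trans; cong; cong₂; subst; subst₂; ≢-sym; module ≡-Reasoning)
open import Relation.Nullary using (¬_; Dec; yes; no; does; contradiction)
open import Relation.Nullary.Decidable using (_×-dec_; _⊎-dec_; ¬?; T?)
open import Relation.Unary using (Decidable)

open import Algebra.Properties.CommutativeSemigroup +-commutativeSemigroup using (interchange)
open import Algebra.Properties.CommutativeSemigroup
  (CommutativeMonoid.commutativeSemigroup ∧-commutativeMonoid) using (x∙yz≈y∙xz)

private
  variable
    n : ℕ

degree : Graph n → Fin n → ℕ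
degree G x = count (adj G x)

_─_ : (Fin n → Bool) → Fin n → Fin n → Bool
(P ─ a) i = P i ∧ not (does (i ≟ a))

∈-─ : ∀ {P : Fin n → Bool} {a i} → T (P i) → i ≢ a → T ((P ─ a) i)
∈-─ {P = P} {a} {i} Pi i≢a with i ≟ a
... | yes i≡a = contradiction i≡a i≢a
... | no _    = subst T (sym (∧-identityʳ (P i))) Pi

count-cong : ∀ {P Q : Fin n → Bool} → (∀ i → P i ≡ Q i) → count P ≡ count Q
count-cong {zero}          P≗Q = refl
count-cong {suc n} {P} {Q} P≗Q with P zero | Q zero | P≗Q zero
... | true  | .true  | refl = cong suc (count-cong (P≗Q ∘ suc))
... | false | .false | refl = count-cong (P≗Q ∘ suc)

count-≤ : ∀ (P : Fin n → Bool) → count P ≤ n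
count-≤ {zero}  P = z≤n
count-≤ {suc n} P with P zero
... | true  = s≤s (count-≤ (P ∘ suc))
... | false = ≤-trans (count-≤ (P ∘ suc)) (n≤1+n n)

count-false : count {n} (λ _ → false) ≡ 0
count-false {zero}  = refl
count-false {suc n} = count-false {n}

count-─ : ∀ (P : Fin n → Bool) {a} → T (P a) → count P ≡ suc (count (P ─ a))
count-─ {suc n} P {zero} Pa with P zero
... | true = cong suc (count-cong (λ i → sym (∧-identityʳ (P (suc i)))))
count-─ {suc n} P {suc a} Pa with P zero
... | true  = cong suc (count-─ (P ∘ suc) Pa)
... | false = count-─ (P ∘ suc) Pa

count-distinct : ∀ (P : Fin n → Bool) {xs} → Unique xs → All (T ∘ P) xs → length xs ≤ count P
count-distinct P []               []         = z≤n
count-distinct P (x∉xs ∷ distinct) (Px ∷ Pxs) rewrite count-─ P Px =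
  s≤s (count-distinct (P ─ _) distinct
        (All.zipWith (λ (Pi , x≢i) → ∈-─ {P = P} Pi (≢-sym x≢i)) (Pxs , x∉xs)))

count-split : ∀ (P Q : Fin n → Bool) →
  count P ≡ count (λ i → Q i ∧ P i) + count (λ i → not (Q i) ∧ P i)
count-split {zero}  P Q = refl
count-split {suc n} P Q with Q zero | P zero
... | true  | true  = cong suc (count-split (P ∘ suc) (Q ∘ suc))
... | true  | false = count-split (P ∘ suc) (Q ∘ suc)
... | false | true  = trans (cong suc (count-split (P ∘ suc) (Q ∘ suc))) (sym (+-suc _ _))
... | false | false = count-split (P ∘ suc) (Q ∘ suc)

fourDistinct-Fin3 : ∀ (a b c d : Fin 3) → a ≢ b → a ≢ c → a ≢ d → b ≢ c → b ≢ d → c ≢ d → ⊥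
fourDistinct-Fin3 a b c d a≢b a≢c a≢d b≢c b≢d c≢d =
  ≤⇒≯ (count-≤ {3} (λ _ → true))
      (count-distinct (λ _ → true)
        ((a≢b ∷ a≢c ∷ a≢d ∷ []) ∷ (b≢c ∷ b≢d ∷ []) ∷ (c≢d ∷ []) ∷ [] ∷ [])
        (tt ∷ tt ∷ tt ∷ tt ∷ []))

sumFin-cong : ∀ {f g : Fin n → ℕ} → (∀ i → f i ≡ g i) → sumFin f ≡ sumFin g
sumFin-cong {zero}  f≗g = refl
sumFin-cong {suc n} f≗g = cong₂ _+_ (f≗g zero) (sumFin-cong (f≗g ∘ suc))

sumFin-zero : sumFin {n} (λ _ → 0) ≡ 0
sumFin-zero {zero}  = refl
sumFin-zero {suc n} = sumFin-zero {n}

sumFin-+ : ∀ (f g : Fin n → ℕ) → sumFin (λ i → f i + g i) ≡ sumFin f + sumFin g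
sumFin-+ {zero}  f g = refl
sumFin-+ {suc n} f g =
  trans (cong (f zero + g zero +_) (sumFin-+ (f ∘ suc) (g ∘ suc)))
        (interchange (f zero) (g zero) _ _)

sumFin-swap : ∀ {m} (f : Fin m → Fin n → ℕ) →
  sumFin (λ u → sumFin (f u)) ≡ sumFin (λ v → sumFin (λ u → f u v))
sumFin-swap {n} {zero}  f = sym (sumFin-zero {n})
sumFin-swap {n} {suc m} f =
  trans (cong (sumFin (f zero) +_) (sumFin-swap (f ∘ suc)))
        (sym (sumFin-+ (f zero) (λ v → sumFin (λ u → f (suc u) v))))

sumFin-mono : ∀ {f g : Fin n → ℕ} → (∀ i → f i ≤ g i) → sumFin f ≤ sumFin g
sumFin-mono {zero}  f≤g = z≤n
sumFin-mono {suc n} f≤g = +-mono-≤ (f≤g zero) (sumFin-mono (f≤g ∘ suc))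

sumFin-mono-< : ∀ {f g : Fin n → ℕ} → (∀ i → f i ≤ g i) → ∀ j → f j < g j → sumFin f < sumFin g
sumFin-mono-< {suc n} f≤g zero    fj<gj = +-mono-<-≤ fj<gj (sumFin-mono (f≤g ∘ suc))
sumFin-mono-< {suc n} f≤g (suc j) fj<gj = +-mono-≤-< (f≤g zero) (sumFin-mono-< (f≤g ∘ suc) j fj<gj)

sumFin-squeeze : ∀ (f g : Fin n → ℕ) → (∀ i → g i ≤ f i) → sumFin f ≤ sumFin g → ∀ i → f i ≤ g i
sumFin-squeeze f g g≤f Σf≤Σg i with f i ≤? g i
... | yes fi≤gi = fi≤gi
... | no  fi≰gi = contradiction (sumFin-mono-< g≤f i (≰⇒> fi≰gi)) (≤⇒≯ Σf≤Σg)

sumFin-if : ∀ k (P : Fin n → Bool) → sumFin (λ i → if P i then k else 0) ≡ k * count P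
sumFin-if {zero}  k P = sym (*-zeroʳ k)
sumFin-if {suc n} k P with P zero
... | true  = trans (cong (k +_) (sumFin-if k (P ∘ suc))) (sym (*-suc k _))
... | false = sumFin-if k (P ∘ suc)

count-as-sumFin : ∀ (P : Fin n → Bool) → count P ≡ sumFin (λ i → if P i then 1 else 0)
count-as-sumFin P = sym (trans (sumFin-if 1 P) (*-identityˡ _))

count-swap : ∀ {m} (R : Fin m → Fin n → Bool) →
  sumFin (λ u → count (R u)) ≡ sumFin (λ v → count (λ u → R u v))
count-swap R = begin
  sumFin (λ u → count (R u))
    ≡⟨ sumFin-cong (λ u → count-as-sumFin (R u)) ⟩
  sumFin (λ u → sumFin (λ v → if R u v then 1 else 0))
    ≡⟨ sumFin-swap (λ u v → if R u v then 1 else 0) ⟩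
  sumFin (λ v → sumFin (λ u → if R u v then 1 else 0))
    ≡⟨ sumFin-cong (λ v → sym (count-as-sumFin (λ u → R u v))) ⟩
  sumFin (λ v → count (λ u → R u v)) ∎
  where open ≡-Reasoning

edges : Graph n → ℕ
edges G = sumFin (λ u → count (λ v → (toℕ u <ᵇ toℕ v) ∧ adj G u v))

not-<ᵇ : ∀ {a b} → a ≢ b → not (a <ᵇ b) ≡ (b <ᵇ a)
not-<ᵇ {zero}  {zero}  a≢b = contradiction refl a≢b
not-<ᵇ {zero}  {suc b} a≢b = refl
not-<ᵇ {suc a} {zero}  a≢b = refl
not-<ᵇ {suc a} {suc b} a≢b = not-<ᵇ (a≢b ∘ cong suc)

handshake : ∀ (G : Graph n) → sumFin (degree G) ≡ edges G + edges G
handshake G = begin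
  sumFin (degree G)
    ≡⟨ sumFin-cong (λ u → count-split (adj G u) (λ v → toℕ u <ᵇ toℕ v)) ⟩
  sumFin (λ u → above u + notAbove u)
    ≡⟨ sumFin-+ above notAbove ⟩
  edges G + sumFin notAbove
    ≡⟨ cong (edges G +_) (sumFin-cong (λ u → count-cong (notAbove≡below u))) ⟩
  edges G + sumFin (λ u → count (λ v → (toℕ v <ᵇ toℕ u) ∧ adj G u v))
    ≡⟨ cong (edges G +_) (count-swap (λ u v → (toℕ v <ᵇ toℕ u) ∧ adj G u v)) ⟩
  edges G + sumFin (λ v → count (λ u → (toℕ v <ᵇ toℕ u) ∧ adj G u v))
    ≡⟨ cong (edges G +_) (sumFin-cong λ v → count-cong λ u →
         cong ((toℕ v <ᵇ toℕ u) ∧_) (Graph.sym G u v)) ⟩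
  edges G + edges G ∎
  where
  open ≡-Reasoning
  above notAbove : Fin _ → ℕ
  above    u = count (λ v → (toℕ u <ᵇ toℕ v) ∧ adj G u v)
  notAbove u = count (λ v → not (toℕ u <ᵇ toℕ v) ∧ adj G u v)
  notAbove≡below : ∀ u v → not (toℕ u <ᵇ toℕ v) ∧ adj G u v ≡ (toℕ v <ᵇ toℕ u) ∧ adj G u v
  notAbove≡below u v with u ≟ v
  ... | yes refl rewrite irrefl G u | ∧-zeroʳ (not (toℕ u <ᵇ toℕ u)) | ∧-zeroʳ (toℕ u <ᵇ toℕ u) = refl
  ... | no  u≢v  rewrite not-<ᵇ (u≢v ∘ toℕ-injective) = refl

_↾_ : Graph n → (Fin n → Bool) → Graph n
B ↾ S = record
  { adj    = λ u v → S u ∧ (S v ∧ adj B u v)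
  ; sym    = λ u v → trans (cong (λ e → S u ∧ (S v ∧ e)) (Graph.sym B u v))
                           (x∙yz≈y∙xz (S u) (S v) (adj B v u))
  ; irrefl = λ u → trans (cong (λ e → S u ∧ (S u ∧ e)) (irrefl B u))
                         (trans (cong (S u ∧_) (∧-zeroʳ (S u))) (∧-zeroʳ (S u)))
  }

induced-edge : ∀ {B : Graph n} {S u v} → T (S u) → T (S v) → T (adj B u v) → T (adj (B ↾ S) u v)
induced-edge {S = S} {u} {v} Su Sv uv =
  Equivalence.from (T-∧ {S u}) (Su , Equivalence.from (T-∧ {S v}) (Sv , uv))

edge-of-induced : ∀ {B : Graph n} {S u v} → T (adj (B ↾ S) u v) → T (S u) × T (S v) × T (adj B u v)
edge-of-induced {S = S} {u} {v} e with Equivalence.to (T-∧ {S u}) e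
... | Su , e′ = Su , Equivalence.to (T-∧ {S v}) e′

inducedSubgraph : (B : Graph n) → (Fin n → Bool) → Subgraph B
inducedSubgraph B S = record
  { vs     = S
  ; es     = adj (B ↾ S)
  ; es-sym = Graph.sym (B ↾ S)
  ; es⊆adj = λ u v e → proj₂ (proj₂ (edge-of-induced {B = B} {S} e))
  ; es⊆vs  = λ u v e → let (Su , Sv , _) = edge-of-induced {B = B} {S} e in Su , Sv
  }

↾-─ : ∀ {B : Graph n} {S x u v} → u ≢ x → v ≢ x → T (adj (B ↾ S) u v) → T (adj (B ↾ (S ─ x)) u v)
↾-─ {B = B} {S} u≢x v≢x e with edge-of-induced {B = B} {S} e
... | Su , Sv , uv = induced-edge {B = B} {S ─ _} (∈-─ {P = S} Su u≢x) (∈-─ {P = S} Sv v≢x) uv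

degree-outside : ∀ {B : Graph n} {S x} → ¬ T (S x) → degree (B ↾ S) x ≡ 0
degree-outside {n} {S = S} {x} x∉S with S x
... | true  = contradiction tt x∉S
... | false = count-false {n}

minDegree≥3⇒maxDegree≤3 : ∀ {B : Graph n} → m≤3/2 B → ∀ S →
  (∀ x → T (S x) → 3 ≤ degree (B ↾ S) x) → ∀ x → degree (B ↾ S) x ≤ 3
minDegree≥3⇒maxDegree≤3 {B = B} sparse S high x with T? (S x)
... | no  x∉S = subst (_≤ 3) (sym (degree-outside {B = B} {S} x∉S)) z≤n
... | yes x∈S = ≤-trans (sumFin-squeeze (degree (B ↾ S)) weight weight≤degree Σdegree≤Σweight x)
                        (weight≤3 x)
  where
  weight : Fin _ → ℕ
  weight y = if S y then 3 else 0
  weight≤3 : ∀ y → weight y ≤ 3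
  weight≤3 y with S y
  ... | true  = ≤-refl
  ... | false = z≤n
  weight≤degree : ∀ y → weight y ≤ degree (B ↾ S) y
  weight≤degree y with S y | high y
  ... | true  | h = h tt
  ... | false | _ = z≤n
  Σdegree≤Σweight : sumFin (degree (B ↾ S)) ≤ sumFin weight
  Σdegree≤Σweight = begin
    sumFin (degree (B ↾ S))        ≡⟨ handshake (B ↾ S) ⟩
    edges (B ↾ S) + edges (B ↾ S)  ≡⟨ cong (edges (B ↾ S) +_) (sym (+-identityʳ _)) ⟩
    2 * edges (B ↾ S)              ≤⟨ sparse (inducedSubgraph B S) 1≤|S| ⟩
    3 * count S                    ≡⟨ sym (sumFin-if 3 S) ⟩
    sumFin weight                  ∎
    where
    open ≤-Reasoning
    1≤|S| : 1 ≤ count S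
    1≤|S| = count-distinct S ([] ∷ []) (x∈S ∷ [])

module _ {A : Set} {R : Fin n → Fin n → Set} (R? : ∀ u v → Dec (R u v))
         (k : A) (c : Fin n → Fin n → A) where

  recolour : Fin n → Fin n → A
  recolour u v with R? u v
  ... | yes _ = k
  ... | no  _ = c u v

  recolour-inside : ∀ {u v} → R u v → recolour u v ≡ k
  recolour-inside {u} {v} r with R? u v
  ... | yes _ = refl
  ... | no ¬r = contradiction r ¬r

  recolour-outside : ∀ {u v} → ¬ R u v → recolour u v ≡ c u v
  recolour-outside {u} {v} ¬r with R? u v
  ... | yes r = contradiction r ¬r
  ... | no  _ = refl

  recolour-sym : (∀ {u v} → R u v → R v u) → (∀ u v → c u v ≡ c v u) →
    ∀ u v → recolour u v ≡ recolour v u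
  recolour-sym R-sym c-sym u v with R? u v
  ... | yes r = sym (recolour-inside (R-sym r))
  ... | no ¬r = trans (c-sym u v) (sym (recolour-outside (¬r ∘ R-sym)))

record GoodColouring (G : Graph n) (bound : ℕ) : Set where
  field
    colouring  : EdgeColouring G
    no-mono    : ¬ MonoK13 G colouring
    no-rainbow : ¬ RainbowC4 G colouring
    bounded    : ∀ {u v} → T (adj G u v) → col colouring u v < bound

goodColouring-mono : ∀ {G : Graph n} {k k′} → k ≤ k′ → GoodColouring G k → GoodColouring G k′
goodColouring-mono k≤k′ good = record
  { colouring = colouring ; no-mono = no-mono ; no-rainbow = no-rainbow
  ; bounded = λ e → ≤-trans (bounded e) k≤k′ }
  where open GoodColouring good

module _ {G G′ : Graph n} {x : Fin n} {k k′ : ℕ}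
         (deg≤2 : degree G x ≤ 2)
         (G-x⊆G′ : ∀ {u v} → u ≢ x → v ≢ x → T (adj G u v) → T (adj G′ u v))
         (k<k′ : k < k′) (good : GoodColouring G′ k) where

  open GoodColouring good using (no-mono; no-rainbow; bounded) renaming (colouring to c′)

  private
    AtX : Fin n → Fin n → Set
    AtX u v = u ≡ x ⊎ v ≡ x

    atX? : ∀ u v → Dec (AtX u v)
    atX? u v = (u ≟ x) ⊎-dec (v ≟ x)

    c : Fin n → Fin n → ℕ
    c = recolour atX? k (col c′)

    c-at : ∀ {u v} → AtX u v → c u v ≡ k
    c-at = recolour-inside atX? k (col c′)

    c-away : ∀ {u v} → u ≢ x → v ≢ x → c u v ≡ col c′ u v
    c-away u≢x v≢x = recolour-outside atX? k (col c′) [ u≢x , v≢x ]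

    c-away-< : ∀ {u v} → u ≢ x → v ≢ x → T (adj G u v) → c u v < k
    c-away-< u≢x v≢x uv = subst (_< k) (sym (c-away u≢x v≢x)) (bounded (G-x⊆G′ u≢x v≢x uv))

    clash : ∀ {u v a b} → AtX u v → a ≢ x → b ≢ x → T (adj G a b) → c u v ≢ c a b
    clash at a≢x b≢x ab e = <-irrefl (trans (sym e) (c-at at)) (c-away-< a≢x b≢x ab)

    colouring : EdgeColouring G
    colouring = record
      { col     = c
      ; col-sym = recolour-sym atX? k (col c′) ⊎-swap (col-sym c′) }

    no-mono′ : ¬ MonoK13 G colouring
    no-mono′ (y , a , b , d , y≢a , y≢b , y≢d , a≢b , a≢d , b≢d , ya , yb , yd , ≡ab , ≡ad) =
      cases (y ≟ x) (a ≟ x) (b ≟ x) (d ≟ x)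
      where
      cases : Dec (y ≡ x) → Dec (a ≡ x) → Dec (b ≡ x) → Dec (d ≡ x) → ⊥
      cases (yes y≡x) _ _ _ =
        ≤⇒≯ (subst (λ z → degree G z ≤ 2) (sym y≡x) deg≤2)
            (count-distinct (adj G y) ((a≢b ∷ a≢d ∷ []) ∷ (b≢d ∷ []) ∷ [] ∷ []) (ya ∷ yb ∷ yd ∷ []))
      cases (no y≢x) (yes a≡x) _ _ = clash {y} (inj₂ a≡x) y≢x (λ b≡x → a≢b (trans a≡x (sym b≡x))) yb ≡ab
      cases (no y≢x) (no a≢x) (yes b≡x) _ = clash {y} (inj₂ b≡x) y≢x a≢x ya (sym ≡ab)
      cases (no y≢x) (no a≢x) (no b≢x) (yes d≡x) = clash {y} (inj₂ d≡x) y≢x a≢x ya (sym ≡ad)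
      cases (no y≢x) (no a≢x) (no b≢x) (no d≢x) =
        no-mono (y , a , b , d , y≢a , y≢b , y≢d , a≢b , a≢d , b≢d ,
                 G-x⊆G′ y≢x a≢x ya , G-x⊆G′ y≢x b≢x yb , G-x⊆G′ y≢x d≢x yd ,
                 subst₂ _≡_ (c-away y≢x a≢x) (c-away y≢x b≢x) ≡ab ,
                 subst₂ _≡_ (c-away y≢x a≢x) (c-away y≢x d≢x) ≡ad)

    no-rainbow′ : ¬ RainbowC4 G colouring
    no-rainbow′ (v₀ , v₁ , v₂ , v₃ , d₀₁ , d₀₂ , d₀₃ , d₁₂ , d₁₃ , d₂₃ , e₀₁ , e₁₂ , e₂₃ , e₃₀ ,
                 n₀₁₋₁₂ , n₀₁₋₂₃ , n₀₁₋₃₀ , n₁₂₋₂₃ , n₁₂₋₃₀ , n₂₃₋₃₀) =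
      cases (v₀ ≟ x) (v₁ ≟ x) (v₂ ≟ x) (v₃ ≟ x)
      where
      same : ∀ u v a b → AtX u v → AtX a b → c u v ≡ c a b
      same u v a b p q = trans (c-at p) (sym (c-at q))
      cases : Dec (v₀ ≡ x) → Dec (v₁ ≡ x) → Dec (v₂ ≡ x) → Dec (v₃ ≡ x) → ⊥
      cases (yes v₀≡x) _ _ _ = n₀₁₋₃₀ (same v₀ v₁ v₃ v₀ (inj₁ v₀≡x) (inj₂ v₀≡x))
      cases (no _) (yes v₁≡x) _ _ = n₀₁₋₁₂ (same v₀ v₁ v₁ v₂ (inj₂ v₁≡x) (inj₁ v₁≡x))
      cases (no _) (no _) (yes v₂≡x) _ = n₁₂₋₂₃ (same v₁ v₂ v₂ v₃ (inj₂ v₂≡x) (inj₁ v₂≡x))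
      cases (no _) (no _) (no _) (yes v₃≡x) = n₂₃₋₃₀ (same v₂ v₃ v₃ v₀ (inj₂ v₃≡x) (inj₁ v₃≡x))
      cases (no m₀) (no m₁) (no m₂) (no m₃) =
        no-rainbow (v₀ , v₁ , v₂ , v₃ , d₀₁ , d₀₂ , d₀₃ , d₁₂ , d₁₃ , d₂₃ ,
                    G-x⊆G′ m₀ m₁ e₀₁ , G-x⊆G′ m₁ m₂ e₁₂ , G-x⊆G′ m₂ m₃ e₂₃ , G-x⊆G′ m₃ m₀ e₃₀ ,
                    subst₂ _≢_ c₀₁ c₁₂ n₀₁₋₁₂ , subst₂ _≢_ c₀₁ c₂₃ n₀₁₋₂₃ , subst₂ _≢_ c₀₁ c₃₀ n₀₁₋₃₀ ,
                    subst₂ _≢_ c₁₂ c₂₃ n₁₂₋₂₃ , subst₂ _≢_ c₁₂ c₃₀ n₁₂₋₃₀ , subst₂ _≢_ c₂₃ c₃₀ n₂₃₋₃₀)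
        where
        c₀₁ : c v₀ v₁ ≡ col c′ v₀ v₁
        c₀₁ = c-away m₀ m₁
        c₁₂ : c v₁ v₂ ≡ col c′ v₁ v₂
        c₁₂ = c-away m₁ m₂
        c₂₃ : c v₂ v₃ ≡ col c′ v₂ v₃
        c₂₃ = c-away m₂ m₃
        c₃₀ : c v₃ v₀ ≡ col c′ v₃ v₀
        c₃₀ = c-away m₃ m₀

    bounded′ : ∀ {u v} → T (adj G u v) → c u v < k′
    bounded′ {u} {v} uv = by-cases (atX? u v)
      where
      by-cases : Dec (AtX u v) → c u v < k′
      by-cases (yes at) = subst (_< k′) (sym (c-at at)) k<k′
      by-cases (no ¬at) = <-trans (c-away-< (¬at ∘ inj₁) (¬at ∘ inj₂) uv) k<k′

  peel : GoodColouring G k′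
  peel = record
    { colouring = colouring ; no-mono = no-mono′ ; no-rainbow = no-rainbow′ ; bounded = bounded′ }

AtMostOne : {A : Set} → (A → Set) → Set
AtMostOne P = ∀ {i j} → P i → P j → i ≡ j

avoid₃ : ∀ {A B : Fin 3 → Set} → Decidable A → Decidable B → AtMostOne A → AtMostOne B →
  ∃ λ k → ¬ A k × ¬ B k
avoid₃ {A} {B} A? B? A≤1 B≤1 =
  cases (A? zero) (B? zero) (A? (suc zero)) (B? (suc zero)) (A? (suc (suc zero))) (B? (suc (suc zero)))
  where
  cases : Dec (A zero) → Dec (B zero) → Dec (A (suc zero)) → Dec (B (suc zero)) →
          Dec (A (suc (suc zero))) → Dec (B (suc (suc zero))) → ∃ λ k → ¬ A k × ¬ B k
  cases (no ¬a₀) (no ¬b₀) _ _ _ _ = zero , ¬a₀ , ¬b₀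
  cases _ _ (no ¬a₁) (no ¬b₁) _ _ = suc zero , ¬a₁ , ¬b₁
  cases _ _ _ _ (no ¬a₂) (no ¬b₂) = suc (suc zero) , ¬a₂ , ¬b₂
  cases (yes a₀) _ (yes a₁) _ _ _ = contradiction (A≤1 a₀ a₁) λ ()
  cases (yes a₀) _ _ _ (yes a₂) _ = contradiction (A≤1 a₀ a₂) λ ()
  cases _ _ (yes a₁) _ (yes a₂) _ = contradiction (A≤1 a₁ a₂) λ ()
  cases _ (yes b₀) _ (yes b₁) _ _ = contradiction (B≤1 b₀ b₁) λ ()
  cases _ (yes b₀) _ _ _ (yes b₂) = contradiction (B≤1 b₀ b₂) λ ()
  cases _ _ _ (yes b₁) _ (yes b₂) = contradiction (B≤1 b₁ b₂) λ ()

module _ (G : Graph n) (deg≤3 : ∀ x → degree G x ≤ 3) where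

  private
    Pair : Set
    Pair = Fin n × Fin n

    Joins : Pair → Fin n → Fin n → Set
    Joins p a b = (a , b) ≡ p ⊎ (b , a) ≡ p

    joins? : ∀ p a b → Dec (Joins p a b)
    joins? p a b = ≡-dec _≟_ _≟_ (a , b) p ⊎-dec ≡-dec _≟_ _≟_ (b , a) p

    Joins-unique : ∀ {p x a b} → Joins p x a → Joins p x b → a ≡ b
    Joins-unique (inj₁ refl) (inj₁ refl) = refl
    Joins-unique (inj₁ refl) (inj₂ refl) = refl
    Joins-unique (inj₂ refl) (inj₁ refl) = refl
    Joins-unique (inj₂ refl) (inj₂ refl) = refl

    Joins-endpoint : ∀ {u v x a} → Joins (u , v) x a → x ≡ u ⊎ x ≡ v
    Joins-endpoint (inj₁ refl) = inj₁ refl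
    Joins-endpoint (inj₂ refl) = inj₂ refl

    Coloured : List Pair → Fin n → Fin n → Set
    Coloured L a b = T (adj G a b) × Any (λ p → Joins p a b) L

    coloured? : ∀ L a b → Dec (Coloured L a b)
    coloured? L a b = T? (adj G a b) ×-dec Any.any? (λ p → joins? p a b) L

    StarFree : List Pair → (Fin n → Fin n → Fin 3) → Set
    StarFree L c = ∀ {x a b d} → a ≢ b → a ≢ d → b ≢ d →
      Coloured L x a → Coloured L x b → Coloured L x d → c x a ≡ c x b → c x a ≡ c x d → ⊥

    record Partial (L : List Pair) : Set where
      field
        c         : Fin n → Fin n → Fin 3
        c-sym     : ∀ a b → c a b ≡ c b a
        star-free : StarFree L c

    Saturated : List Pair → (Fin n → Fin n → Fin 3) → Fin n → Fin 3 → Set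
    Saturated L c x k = ∃ λ q → ∃ λ r → q ≢ r × Coloured L x q × Coloured L x r × c x q ≡ k × c x r ≡ k

    saturated? : ∀ L c x → Decidable (Saturated L c x)
    saturated? L c x k = any? λ q → any? λ r →
      ¬? (q ≟ r) ×-dec coloured? L x q ×-dec coloured? L x r ×-dec c x q ≟ k ×-dec c x r ≟ k

    saturated-unique : ∀ L c x → AtMostOne (Saturated L c x)
    saturated-unique L c x {k₁} {k₂} (q₁ , r₁ , q₁≢r₁ , q₁∈ , r₁∈ , cq₁ , cr₁)
                                     (q₂ , r₂ , q₂≢r₂ , q₂∈ , r₂∈ , cq₂ , cr₂)
      with k₁ ≟ k₂
    ... | yes k₁≡k₂ = k₁≡k₂
    ... | no  k₁≢k₂ = contradiction
      (count-distinct (adj G x)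
        ((q₁≢r₁ ∷ apart cq₁ cq₂ ∷ apart cq₁ cr₂ ∷ []) ∷ (apart cr₁ cq₂ ∷ apart cr₁ cr₂ ∷ []) ∷
         (q₂≢r₂ ∷ []) ∷ [] ∷ [])
        (proj₁ q₁∈ ∷ proj₁ r₁∈ ∷ proj₁ q₂∈ ∷ proj₁ r₂∈ ∷ []))
      (≤⇒≯ (deg≤3 x))
      where
      apart : ∀ {a b} → c x a ≡ k₁ → c x b ≡ k₂ → a ≢ b
      apart ca cb refl = k₁≢k₂ (trans (sym ca) cb)

    -- The pair is painted whether or not it is an edge of G: only edges are ever inspected.
    module Extend (u v : Fin n) (L : List Pair) (P : Partial L) where
      open Partial P

      p : Pair
      p = u , v

      free : ∃ λ k → ¬ Saturated L c u k × ¬ Saturated L c v k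
      free = avoid₃ (saturated? L c u) (saturated? L c v)
                    (saturated-unique L c u) (saturated-unique L c v)

      k : Fin 3
      k = proj₁ free

      c′ : Fin n → Fin n → Fin 3
      c′ = recolour (joins? p) k c

      inside : ∀ {a b} → Joins p a b → c′ a b ≡ k
      inside = recolour-inside (joins? p) k c

      outside : ∀ {a b} → ¬ Joins p a b → c′ a b ≡ c a b
      outside = recolour-outside (joins? p) k c

      old : ∀ {a b} → Coloured (p ∷ L) a b → ¬ Joins p a b → Coloured L a b
      old (ab , here j)  ¬j = contradiction j ¬j
      old (ab , there l) _  = ab , l

      new-edge : ∀ {x a b d} → Joins p x a → b ≢ d → Coloured (p ∷ L) x b → Coloured (p ∷ L) x d →
                 a ≢ b → a ≢ d → c′ x a ≡ c′ x b → c′ x a ≡ c′ x d → ⊥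
      new-edge {x} {a} {b} {d} j b≢d xb xd a≢b a≢d ≡ab ≡ad =
        [ (λ x≡u → proj₁ (proj₂ free) (subst (λ z → Saturated L c z k) x≡u saturated))
        , (λ x≡v → proj₂ (proj₂ free) (subst (λ z → Saturated L c z k) x≡v saturated))
        ] (Joins-endpoint j)
        where
        ¬jb : ¬ Joins p x b
        ¬jb jb = a≢b (Joins-unique j jb)
        ¬jd : ¬ Joins p x d
        ¬jd jd = a≢d (Joins-unique j jd)
        saturated : Saturated L c x k
        saturated = b , d , b≢d , old xb ¬jb , old xd ¬jd ,
                    trans (sym (outside ¬jb)) (trans (sym ≡ab) (inside j)) ,
                    trans (sym (outside ¬jd)) (trans (sym ≡ad) (inside j))

      star-free′ : StarFree (p ∷ L) c′
      star-free′ {x} {a} {b} {d} a≢b a≢d b≢d xa xb xd ≡ab ≡ad =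
        cases (joins? p x a) (joins? p x b) (joins? p x d)
        where
        cases : Dec (Joins p x a) → Dec (Joins p x b) → Dec (Joins p x d) → ⊥
        cases (yes j) _ _ = new-edge j b≢d xb xd a≢b a≢d ≡ab ≡ad
        cases (no _) (yes j) _ = new-edge j a≢d xa xd (≢-sym a≢b) b≢d (sym ≡ab) (trans (sym ≡ab) ≡ad)
        cases (no _) (no _) (yes j) =
          new-edge j a≢b xa xb (≢-sym a≢d) (≢-sym b≢d) (sym ≡ad) (trans (sym ≡ad) ≡ab)
        cases (no ¬ja) (no ¬jb) (no ¬jd) =
          star-free a≢b a≢d b≢d (old xa ¬ja) (old xb ¬jb) (old xd ¬jd)
            (subst₂ _≡_ (outside ¬ja) (outside ¬jb) ≡ab) (subst₂ _≡_ (outside ¬ja) (outside ¬jd) ≡ad)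

      extended : Partial (p ∷ L)
      extended = record
        { c = c′ ; c-sym = recolour-sym (joins? p) k c ⊎-swap c-sym ; star-free = star-free′ }

    partial : ∀ L → Partial L
    partial []            = record
      { c = λ _ _ → zero ; c-sym = λ _ _ → refl ; star-free = λ { _ _ _ (_ , ()) } }
    partial ((u , v) ∷ L) = Extend.extended u v L (partial L)

    allPairs : List Pair
    allPairs = cartesianProduct (allFin n) (allFin n)

    listed : ∀ a b → Any (λ p → Joins p a b) allPairs
    listed a b = Any.map inj₁ (∈-cartesianProduct⁺ (∈-allFin a) (∈-allFin b))

  maxDegree≤3⇒goodColouring : GoodColouring G 3
  maxDegree≤3⇒goodColouring = record
    { colouring  = colouring
    ; no-mono    = no-mono
    ; no-rainbow = no-rainbow
    ; bounded    = λ _ → toℕ<n _ }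
    where
    open Partial (partial allPairs)
    colouring : EdgeColouring G
    colouring = record { col = λ a b → toℕ (c a b) ; col-sym = λ a b → cong toℕ (c-sym a b) }
    no-mono : ¬ MonoK13 G colouring
    no-mono (x , a , b , d , _ , _ , _ , a≢b , a≢d , b≢d , xa , xb , xd , ≡ab , ≡ad) =
      star-free a≢b a≢d b≢d (xa , listed x a) (xb , listed x b) (xd , listed x d)
        (toℕ-injective ≡ab) (toℕ-injective ≡ad)
    no-rainbow : ¬ RainbowC4 G colouring
    no-rainbow (_ , _ , _ , _ , _ , _ , _ , _ , _ , _ , _ , _ , _ , _ , n₁ , n₂ , n₃ , n₄ , n₅ , n₆) =
      fourDistinct-Fin3 _ _ _ _ (n₁ ∘ cong toℕ) (n₂ ∘ cong toℕ) (n₃ ∘ cong toℕ)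
                                (n₄ ∘ cong toℕ) (n₅ ∘ cong toℕ) (n₆ ∘ cong toℕ)

module _ {B : Graph n} (sparse : m≤3/2 B) where

  goodColouring-core : ∀ S → (∀ x → T (S x) → 3 ≤ degree (B ↾ S) x) →
                       GoodColouring (B ↾ S) (3 + count S)
  goodColouring-core S high =
    goodColouring-mono (m≤m+n 3 (count S))
      (maxDegree≤3⇒goodColouring (B ↾ S) (minDegree≥3⇒maxDegree≤3 sparse S high))

  -- Colours below 3 belong to the degree-3 core; the vertex peeled from S gets colour 2 + count S.
  goodColouring-induced : ∀ k S → count S ≤ k → GoodColouring (B ↾ S) (3 + count S)
  goodColouring-induced zero S |S|≤0 = goodColouring-core S λ x x∈S →
    contradiction (≤-trans (count-distinct S ([] ∷ []) (x∈S ∷ [])) |S|≤0) λ ()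
  goodColouring-induced (suc k) S |S|≤1+k with any? (λ x → T? (S x) ×-dec degree (B ↾ S) x ≤? 2)
  ... | no ∄low = goodColouring-core S λ x x∈S → ≰⇒> λ deg≤2 → ∄low (x , x∈S , deg≤2)
  ... | yes (x , x∈S , deg≤2) =
    peel deg≤2 (↾-─ {B = B} {S}) (≤-reflexive (cong (3 +_) (sym |S|≡1+|S─x|)))
      (goodColouring-induced k (S ─ x) (s≤s⁻¹ (subst (_≤ suc k) |S|≡1+|S─x| |S|≤1+k)))
    where
    |S|≡1+|S─x| : count S ≡ suc (count (S ─ x))
    |S|≡1+|S─x| = count-─ S x∈S

lemma3p3 : ∀ (n : ℕ) (B : Graph n) → m≤3/2 B →
               Σ (EdgeColouring B) λ c → ¬ MonoK13 B c × ¬ RainbowC4 B c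
lemma3p3 n B sparse =
  record { col = col colouring ; col-sym = col-sym colouring } , no-mono , no-rainbow
  where
  -- B ↾ (λ _ → true) has the adjacency of B on the nose, so both properties transfer unchanged.
  open GoodColouring (goodColouring-induced sparse n (λ _ → true) (count-≤ _))
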